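{- If $H$ is the clique substitution of a graph $G$, then $H$ is $(C_4,C_5)$-free.
   Context: The clique substitution $H$ of a graph $G=(V,E)$ is defined as follows: for each $v\in V$, $H$ contains a clique $K^v$ with vertex set $\{(v,u): u \in N_G(v)\}$ (pairwise vertex-disjoint), and for each edge $uv\in E$, $H$ contains the edge $(v,u)(u,v)$; there are no other edges. $C_t$ is the cycle on $t$ vertices; $(C_4,C_5)$-free means no induced subgraph isomorphic to $C_4$ or $C_5$. -}

module Defs where

open import Data.Nat using (ℕ; zero; suc)
open import Data.Fin using (Fin; toℕ)
open import Data.Product using (_×_; Σ; _,_; proj₁; proj₂)
open import Data.Sum using (_⊎_)
open import Relation.Nullary using (¬_)
open import Relation.Binary.PropositionalEquality using (_≡_; _≢_)
open import Function.Bundles using (_⇔_)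

record Graph (n : ℕ) : Set₁ where
  field
    Adj    : Fin n → Fin n → Set
    sym    : ∀ {u v} → Adj u v → Adj v u
    irrefl : ∀ v → ¬ Adj v v
open Graph public

-- Clique substitution H of G.
-- Vertices of H: pairs (v , u) with u ∈ N_G(v)  (i.e. the vertex (v,u) of K^v).
CSVertex : ∀ {n} → Graph n → Fin n × Fin n → Set
CSVertex G (v , u) = Adj G v u

-- Edges of H: inside each clique K^v all distinct vertices are adjacent,
-- plus the edges (v,u)(u,v) for uv ∈ E(G); nothing else.
CSAdj : ∀ {n} → Graph n → Fin n × Fin n → Fin n × Fin n → Set
CSAdj G (v , u) (v' , u') = (v ≡ v' × u ≢ u') ⊎ (v ≡ u' × u ≡ v')

-- Adjacency in the cycle C_t on vertex set Fin t (i ~ i+1 mod t); meant for t ≥ 3.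
CycAdj : (t : ℕ) → Fin t → Fin t → Set
CycAdj t i j =
  (suc (toℕ i) ≡ toℕ j) ⊎ (suc (toℕ j) ≡ toℕ i)
  ⊎ (toℕ i ≡ 0 × suc (toℕ j) ≡ t) ⊎ (toℕ j ≡ 0 × suc (toℕ i) ≡ t)

IsInducedCycle : ∀ {X : Set} (VP : X → Set) (E : X → X → Set) (t : ℕ) (f : Fin t → X) → Set
IsInducedCycle VP E t f =
  (∀ i → VP (f i))
  × (∀ i j → f i ≡ f j → i ≡ j)
  × (∀ i j → E (f i) (f j) ⇔ CycAdj t i j)

HasInducedCycle : ∀ {X : Set} (VP : X → Set) (E : X → X → Set) (t : ℕ) → Set
HasInducedCycle {X} VP E t = Σ (Fin t → X) (IsInducedCycle VP E t)

{-# OPTIONS --safe #-}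
-- Every edge of H either stays inside one clique K^v or is a matching edge (v,u)(u,v).
-- In an induced cycle of length at least 4, two consecutive clique edges would close a
-- chord inside their clique, and two consecutive matching edges would return to the
-- starting vertex.  So the two kinds of edges alternate around the cycle, which parity
-- rules out for C₅.  An alternating C₄ passes through just two cliques, joined by two
-- different matching edges, whereas distinct cliques are joined by at most one.
module Submission where

open import Defs hiding (sym)
open import Data.Nat as ℕ using (ℕ; suc)
open import Data.Fin as Fin using (Fin; toℕ)
open import Data.Product using (_×_; _,_; proj₁; proj₂)
open import Data.Sum using (_⊎_; inj₁; inj₂)
open import Data.Empty using (⊥)
open import Relation.Nullary using (¬_; Dec)
open import Relation.Nullary.Decidable using (True; False; toWitness; toWitnessFalse; _⊎-dec_; _×-dec_)
open import Relation.Binary.PropositionalEquality using (_≡_; _≢_; sym; trans; cong₂)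
open import Function.Bundles using (_⇔_; module Equivalence)

cycAdj? : ∀ t i j → Dec (CycAdj t i j)
cycAdj? t i j =
  (suc (toℕ i) ℕ.≟ toℕ j) ⊎-dec (suc (toℕ j) ℕ.≟ toℕ i)
  ⊎-dec ((toℕ i ℕ.≟ 0) ×-dec (suc (toℕ j) ℕ.≟ t)) ⊎-dec ((toℕ j ℕ.≟ 0) ×-dec (suc (toℕ i) ℕ.≟ t))

module InducedCycle {X : Set} {VP : X → Set} {E : X → X → Set} {t : ℕ}
                    (C : HasInducedCycle VP E t) where
  private
    f : Fin t → X
    f = proj₁ C

    f-injective : ∀ i j → f i ≡ f j → i ≡ j
    f-injective = proj₁ (proj₂ (proj₂ C))

    f-adjacency : ∀ i j → E (f i) (f j) ⇔ CycAdj t i j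
    f-adjacency = proj₂ (proj₂ (proj₂ C))

  edge : (i j : Fin t) {_ : True (cycAdj? t i j)} → E (f i) (f j)
  edge i j {adj} = Equivalence.from (f-adjacency i j) (toWitness adj)

  apart : (i j : Fin t) {_ : False (i Fin.≟ j)} {_ : False (cycAdj? t i j)} →
          f i ≢ f j × ¬ E (f i) (f j)
  apart i j {i≢j} {i≁j} =
    (λ fi≡fj → toWitnessFalse i≢j (f-injective i j fi≡fj)) ,
    (λ e → toWitnessFalse i≁j (Equivalence.to (f-adjacency i j) e))

-- (v , u) is the vertex of K^v belonging to the neighbour u of v.  For V = Fin n, _∼_
-- unfolds to CSAdj G, which never consults the edges of G.
module CliqueSubstitution {V : Set} where

  InClique : V × V → V × V → Set
  InClique a b = proj₁ a ≡ proj₁ b × proj₂ a ≢ proj₂ b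

  Matched : V × V → V × V → Set
  Matched a b = proj₁ a ≡ proj₂ b × proj₂ a ≡ proj₁ b

  infix 4 _∼_
  _∼_ : V × V → V × V → Set
  a ∼ b = InClique a b ⊎ Matched a b

  Apart : V × V → V × V → Set
  Apart a c = a ≢ c × ¬ a ∼ c

  inClique-trans : ∀ {a b c} → InClique a b → InClique b c → a ≢ c → InClique a c
  inClique-trans (a₁≡b₁ , _) (b₁≡c₁ , _) a≢c =
    trans a₁≡b₁ b₁≡c₁ , λ a₂≡c₂ → a≢c (cong₂ _,_ (trans a₁≡b₁ b₁≡c₁) a₂≡c₂)

  matched-matched⇒≡ : ∀ {a b c} → Matched a b → Matched b c → a ≡ c
  matched-matched⇒≡ (a₁≡b₂ , a₂≡b₁) (b₁≡c₂ , b₂≡c₁) =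
    cong₂ _,_ (trans a₁≡b₂ b₂≡c₁) (trans a₂≡b₁ b₁≡c₂)

  ¬clique-clique : ∀ {a b c} → Apart a c → InClique a b → InClique b c → ⊥
  ¬clique-clique (a≢c , a≁c) ab bc = a≁c (inj₁ (inClique-trans ab bc a≢c))

  ¬matched-matched : ∀ {a b c} → Apart a c → Matched a b → Matched b c → ⊥
  ¬matched-matched (a≢c , _) ab bc = a≢c (matched-matched⇒≡ ab bc)

  ¬alternating-square : ∀ {a b c d} → InClique a b → Matched b c → InClique c d → Matched d a → ⊥
  ¬alternating-square (_ , a₂≢b₂) (_ , b₂≡c₁) (c₁≡d₁ , _) (d₁≡a₂ , _) =
    a₂≢b₂ (sym (trans b₂≡c₁ (trans c₁≡d₁ d₁≡a₂)))

  no-induced-square : ∀ {a b c d} → Apart a c → Apart b d → Apart c a → Apart d b →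
                      a ∼ b → b ∼ c → c ∼ d → d ∼ a → ⊥
  no-induced-square ac _  _  _  (inj₁ ab) (inj₁ bc) _         _         = ¬clique-clique ac ab bc
  no-induced-square _  bd _  _  _         (inj₁ bc) (inj₁ cd) _         = ¬clique-clique bd bc cd
  no-induced-square _  _  ca _  _         _         (inj₁ cd) (inj₁ da) = ¬clique-clique ca cd da
  no-induced-square _  _  _  db (inj₁ ab) _         _         (inj₁ da) = ¬clique-clique db da ab
  no-induced-square ac _  _  _  (inj₂ ab) (inj₂ bc) _         _         = ¬matched-matched ac ab bc
  no-induced-square _  bd _  _  _         (inj₂ bc) (inj₂ cd) _         = ¬matched-matched bd bc cd
  no-induced-square _  _  ca _  _         _         (inj₂ cd) (inj₂ da) = ¬matched-matched ca cd da
  no-induced-square _  _  _  _  (inj₁ ab) (inj₂ bc) (inj₁ cd) (inj₂ da) = ¬alternating-square ab bc cd da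
  no-induced-square _  _  _  _  (inj₂ ab) (inj₁ bc) (inj₂ cd) (inj₁ da) = ¬alternating-square bc cd da ab

  no-induced-pentagon : ∀ {a b c d e} → Apart a c → Apart b d → Apart c e → Apart d a → Apart e b →
                        a ∼ b → b ∼ c → c ∼ d → d ∼ e → e ∼ a → ⊥
  -- Exhaustive because the five edges cannot alternate between the two kinds.
  no-induced-pentagon ac _  _  _  _  (inj₁ ab) (inj₁ bc) _         _         _         = ¬clique-clique ac ab bc
  no-induced-pentagon _  bd _  _  _  _         (inj₁ bc) (inj₁ cd) _         _         = ¬clique-clique bd bc cd
  no-induced-pentagon _  _  ce _  _  _         _         (inj₁ cd) (inj₁ de) _         = ¬clique-clique ce cd de
  no-induced-pentagon _  _  _  da _  _         _         _         (inj₁ de) (inj₁ ea) = ¬clique-clique da de ea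
  no-induced-pentagon _  _  _  _  eb (inj₁ ab) _         _         _         (inj₁ ea) = ¬clique-clique eb ea ab
  no-induced-pentagon ac _  _  _  _  (inj₂ ab) (inj₂ bc) _         _         _         = ¬matched-matched ac ab bc
  no-induced-pentagon _  bd _  _  _  _         (inj₂ bc) (inj₂ cd) _         _         = ¬matched-matched bd bc cd
  no-induced-pentagon _  _  ce _  _  _         _         (inj₂ cd) (inj₂ de) _         = ¬matched-matched ce cd de
  no-induced-pentagon _  _  _  da _  _         _         _         (inj₂ de) (inj₂ ea) = ¬matched-matched da de ea
  no-induced-pentagon _  _  _  _  eb (inj₂ ab) _         _         _         (inj₂ ea) = ¬matched-matched eb ea ab

open CliqueSubstitution

pattern i0 = Fin.zero
pattern i1 = Fin.suc i0
pattern i2 = Fin.suc i1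
pattern i3 = Fin.suc i2
pattern i4 = Fin.suc i3

lemma4p2 : (n : ℕ) (G : Graph n) →
    ¬ HasInducedCycle (CSVertex G) (CSAdj G) 4 × ¬ HasInducedCycle (CSVertex G) (CSAdj G) 5
lemma4p2 _ G = no-C₄ , no-C₅
  where
  no-C₄ : ¬ HasInducedCycle (CSVertex G) (CSAdj G) 4
  no-C₄ cycle = no-induced-square (apart i0 i2) (apart i1 i3) (apart i2 i0) (apart i3 i1)
                                  (edge i0 i1) (edge i1 i2) (edge i2 i3) (edge i3 i0)
    where
    open InducedCycle {VP = CSVertex G} {E = CSAdj G} cycle

  no-C₅ : ¬ HasInducedCycle (CSVertex G) (CSAdj G) 5
  no-C₅ cycle = no-induced-pentagon (apart i0 i2) (apart i1 i3) (apart i2 i4) (apart i3 i0) (apart i4 i1)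
                                    (edge i0 i1) (edge i1 i2) (edge i2 i3) (edge i3 i4) (edge i4 i0)
    where
    open InducedCycle {VP = CSVertex G} {E = CSAdj G} cycle
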